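{- The following rules are derivable in $\mathtt{CHC}$ (for all formulas $\alpha,\beta$ and finite sets of formulas $\Gamma,\Delta$): ($\neg$-l) from $\Gamma\blacktriangleright\alpha$ infer $\Gamma,\neg\alpha\blacktriangleright$; ($\neg$-r) from $\Gamma,\alpha\blacktriangleright$ infer $\Gamma\blacktriangleright\neg\alpha$; ($\rightarrow$-l(c)) from $\Gamma,\alpha\blacktriangleright$ and $\Delta\blacktriangleright\beta$ infer $\alpha\rightarrow\beta,\Gamma,\Delta\blacktriangleright$; ($\rightarrow$-l(d)) from $\alpha,\Gamma\blacktriangleright\beta$ and $\Delta,\neg\alpha,\beta\blacktriangleright$ infer $\Gamma,\Delta,\alpha\rightarrow\neg\beta\blacktriangleright$.
   Context: Formulas are built from variables with binary $\wedge,\vee,\rightarrow$ and constants $0,1$; $\neg\alpha:=\alpha\rightarrow 0$. A sequent $\Gamma\blacktriangleright\Pi$ is a pair of a finite set $\Gamma$ of formulas and a set $\Pi$ that is empty or a singleton; commas denote union; "$\Gamma\blacktriangleright$" has empty $\Pi$. $\mathtt{CHC}$ has axioms (id) $\alpha\blacktriangleright\alpha$; (0) $0\blacktriangleright$; (1) $\blacktriangleright 1$; rules (w-l) $\Gamma\blacktriangleright\Pi/\alpha,\Gamma\blacktriangleright\Pi$; (w-r) $\Gamma\blacktriangleright/\Gamma\blacktriangleright\alpha$; (cut) $\Gamma\blacktriangleright\alpha$, $\alpha,\Delta\blacktriangleright\Pi/\Gamma,\Delta\blacktriangleright\Pi$; ($\wedge$-l) $\alpha,\Gamma\blacktriangleright\Pi/\alpha\wedge\beta,\Gamma\blacktriangleright\Pi$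 and $\beta,\Gamma\blacktriangleright\Pi/\alpha\wedge\beta,\Gamma\blacktriangleright\Pi$; ($\wedge$-r) $\Gamma\blacktriangleright\alpha$, $\Gamma\blacktriangleright\beta/\Gamma\blacktriangleright\alpha\wedge\beta$; ($\vee$-r) $\Gamma\blacktriangleright\alpha/\Gamma\blacktriangleright\alpha\vee\beta$ and $\Gamma\blacktriangleright\beta/\Gamma\blacktriangleright\alpha\vee\beta$; ($\vee$-l) $\alpha,\Gamma\blacktriangleright\Pi$, $\beta,\Gamma\blacktriangleright\Pi/\alpha\vee\beta,\Gamma\blacktriangleright\Pi$; ($\rightarrow$-l(a)) $\Gamma\blacktriangleright\alpha$, $\Delta,\beta\blacktriangleright\Pi/\Delta,\Gamma,\alpha\rightarrow\beta\blacktriangleright\Pi$; ($\rightarrow$-l(b)) $\neg\alpha,\Gamma\blacktriangleright\beta$, $\Delta,\alpha,\beta\blacktriangleright/\Gamma,\Delta,\alpha\rightarrow\beta\blacktriangleright$; ($\rightarrow$-r) $\alpha,\Gamma\blacktriangleright\beta$, $\Delta,\neg\alpha,\beta\blacktriangleright/\Gamma,\Delta\blacktriangleright\alpha\rightarrow\beta$. A rule is derivable if its conclusion can be derived in $\mathtt{CHC}$ from its premisses. -}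

module Defs where

open import Data.Nat using (ℕ)
open import Data.List using (List; []; _∷_; _++_; [_])
open import Data.Maybe using (Maybe; just; nothing)
open import Data.Product using (_×_; _,_)
open import Data.List.Membership.Propositional using (_∈_)
open import Data.List.Relation.Binary.Subset.Propositional using (_⊆_)

infixr 6 _∧'_
infixr 5 _∨'_
infixr 4 _⇒_
data Fm : Set where
  var   : ℕ → Fm
  𝟘 𝟙   : Fm
  _∧'_ _∨'_ _⇒_ : Fm → Fm → Fm

¬' : Fm → Fm
¬' a = a ⇒ 𝟘

-- Finite sets of formulas are represented by lists, taken up to set equality
-- (same members; order and multiplicity irrelevant). Commas = list append.
_≈ₛ_ : List Fm → List Fm → Set
Γ ≈ₛ Δ = (Γ ⊆ Δ) × (Δ ⊆ Γ)

Succ : Set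
Succ = Maybe Fm

Sequent : Set
Sequent = List Fm × Succ

data CHC (H : List Sequent) : List Fm → Succ → Set where
  hyp  : ∀ {Γ Π} → (Γ , Π) ∈ H → CHC H Γ Π
  set  : ∀ {Γ Γ' Π} → Γ ≈ₛ Γ' → CHC H Γ Π → CHC H Γ' Π
  id   : ∀ {a} → CHC H [ a ] (just a)
  ax0  : CHC H [ 𝟘 ] nothing
  ax1  : CHC H [] (just 𝟙)
  wl   : ∀ {a Γ Π} → CHC H Γ Π → CHC H (a ∷ Γ) Π
  wr   : ∀ {a Γ} → CHC H Γ nothing → CHC H Γ (just a)
  cut  : ∀ {a Γ Δ Π} → CHC H Γ (just a) → CHC H (a ∷ Δ) Π → CHC H (Γ ++ Δ) Π
  ∧l₁  : ∀ {a b Γ Π} → CHC H (a ∷ Γ) Π → CHC H ((a ∧' b) ∷ Γ) Π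
  ∧l₂  : ∀ {a b Γ Π} → CHC H (b ∷ Γ) Π → CHC H ((a ∧' b) ∷ Γ) Π
  ∧r   : ∀ {a b Γ} → CHC H Γ (just a) → CHC H Γ (just b) → CHC H Γ (just (a ∧' b))
  ∨r₁  : ∀ {a b Γ} → CHC H Γ (just a) → CHC H Γ (just (a ∨' b))
  ∨r₂  : ∀ {a b Γ} → CHC H Γ (just b) → CHC H Γ (just (a ∨' b))
  ∨l   : ∀ {a b Γ Π} → CHC H (a ∷ Γ) Π → CHC H (b ∷ Γ) Π → CHC H ((a ∨' b) ∷ Γ) Π
  ⇒la  : ∀ {a b Γ Δ Π} → CHC H Γ (just a) → CHC H (Δ ++ [ b ]) Π
       → CHC H (Δ ++ Γ ++ [ a ⇒ b ]) Π
  ⇒lb  : ∀ {a b Γ Δ} → CHC H (¬' a ∷ Γ) (just b) → CHC H (Δ ++ a ∷ b ∷ []) nothing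
       → CHC H (Γ ++ Δ ++ [ a ⇒ b ]) nothing
  ⇒r   : ∀ {a b Γ Δ} → CHC H (a ∷ Γ) (just b) → CHC H (Δ ++ ¬' a ∷ b ∷ []) nothing
       → CHC H (Γ ++ Δ) (just (a ⇒ b))

Derivable : List Sequent → Sequent → Set
Derivable H (Γ , Π) = CHC H Γ Π

{-# OPTIONS --safe #-}
module Submission where

open import Defs
open import Data.List using (List; []; _∷_; _++_; [_])
open import Data.Maybe using (just; nothing)
open import Data.Product using (_×_; _,_)
open import Data.List.Relation.Unary.Any using (here; there)
open import Data.List.Relation.Binary.Permutation.Propositional
  using (_↭_; ↭-sym; ↭-trans)
open import Data.List.Relation.Binary.Permutation.Propositional.Properties
  using (∈-resp-↭; shift; shifts; ++-comm; ++-assoc; ++-identityʳ)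
open import Relation.Binary.PropositionalEquality using (refl)

exchange : ∀ {H Γ Γ′ Π} → Γ ↭ Γ′ → CHC H Γ Π → CHC H Γ′ Π
exchange p = set (∈-resp-↭ p , ∈-resp-↭ (↭-sym p))

¬-left : ∀ {H Γ a} → CHC H Γ (just a) → CHC H (Γ ++ [ ¬' a ]) nothing
¬-left d = ⇒la {Δ = []} d ax0

¬-right : ∀ {H Γ a} → CHC H (Γ ++ [ a ]) nothing → CHC H Γ (just (¬' a))
¬-right {Γ = Γ} {a} d =
  exchange (++-identityʳ Γ) (⇒r {Δ = []} (wr (exchange (++-comm Γ [ a ]) d)) (wl ax0))

⇒-left-c : ∀ {H Γ Δ a b} →
           CHC H (Γ ++ [ a ]) nothing → CHC H Δ (just b) →
           CHC H ((a ⇒ b) ∷ Γ ++ Δ) nothing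
⇒-left-c {Γ = Γ} {Δ} {a} {b} dΓ dΔ =
  exchange Δ++Γ++a⇒b↭ (⇒lb {Γ = Δ} {Δ = Γ} (wl dΔ) (exchange b∷Γ++a↭ (wl dΓ)))
  where
  b∷Γ++a↭ : b ∷ Γ ++ [ a ] ↭ Γ ++ a ∷ b ∷ []
  b∷Γ++a↭ = ↭-trans (++-comm [ b ] (Γ ++ [ a ])) (++-assoc Γ [ a ] [ b ])

  Δ++Γ++a⇒b↭ : Δ ++ Γ ++ [ a ⇒ b ] ↭ (a ⇒ b) ∷ Γ ++ Δ
  Δ++Γ++a⇒b↭ = ↭-trans (shifts Δ Γ)
    (↭-trans (↭-sym (++-assoc Γ Δ [ a ⇒ b ])) (++-comm (Γ ++ Δ) [ a ⇒ b ]))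

-- An instance of (→-l(b)) at ¬β, whose premisses are supplied by (¬-r) and (¬-l).
⇒-left-d : ∀ {H Γ Δ a b} →
           CHC H (a ∷ Γ) (just b) → CHC H (Δ ++ ¬' a ∷ b ∷ []) nothing →
           CHC H (Γ ++ Δ ++ [ a ⇒ ¬' b ]) nothing
⇒-left-d {Γ = Γ} {Δ} {a} {b} dΓ dΔ =
  exchange (shifts Δ Γ)
    (⇒lb {Γ = Δ} {Δ = Γ}
      (¬-right (exchange (shift (¬' a) Δ [ b ]) dΔ))
      (exchange (↭-sym (shift a Γ [ ¬' b ])) (¬-left dΓ)))

lemma4p4 : (∀ (a : Fm) (Γ : List Fm) →
                Derivable [ (Γ , just a) ] ((Γ ++ [ ¬' a ]) , nothing))
         × (∀ (a : Fm) (Γ : List Fm) →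
                Derivable [ ((Γ ++ [ a ]) , nothing) ] (Γ , just (¬' a)))
         × (∀ (a b : Fm) (Γ Δ : List Fm) →
                Derivable (((Γ ++ [ a ]) , nothing) ∷ (Δ , just b) ∷ [])
                          (((a ⇒ b) ∷ Γ ++ Δ) , nothing))
         × (∀ (a b : Fm) (Γ Δ : List Fm) →
                Derivable (((a ∷ Γ) , just b) ∷ ((Δ ++ ¬' a ∷ b ∷ []) , nothing) ∷ [])
                          ((Γ ++ Δ ++ [ a ⇒ ¬' b ]) , nothing))
lemma4p4 = (λ a Γ → ¬-left (hyp (here refl)))
         , (λ a Γ → ¬-right (hyp (here refl)))
         , (λ a b Γ Δ → ⇒-left-c (hyp (here refl)) (hyp (there (here refl))))
         , (λ a b Γ Δ → ⇒-left-d (hyp (here refl)) (hyp (there (here refl))))
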